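{- Let $G$ be a vertex-colored graph, $T$ a colorful tree, and $H = \textsc{mcg}(G,T)$. Then every edge $xy$ of $H$ is an edge of some subgraph $\widetilde{G}$ of $H$ that is color-isomorphic to $T$.
   Context: A vertex-colored graph is a finite simple undirected graph with a color function $c$ on its vertices; it is colorful if $c$ is injective on its vertices. A color-isomorphism is a graph isomorphism preserving vertex colors. Algorithm \textsc{mcg}$(G,T)$ (input: vertex-colored graph $G$, colorful tree $T$): set $H := G$; delete from $H$ every vertex whose color is not the color of some vertex of $T$; delete from $H$ every edge $vv'$ for which there is no edge $ww' \in E_T$ with $c(v) = c(w)$ and $c(v') = c(w')$; then, while there exist $v \in V_H$ and $w, w' \in V_T$ with $c(v) = c(w)$, $ww' \in E_T$, such that no $v' \in V_H$ satisfies $vv' \in E_H$ and $c(v') = c(w')$, delete $v$ (and its incident edges) from $H$; finally return $H$. -}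

module Defs where

open import Data.Nat using (ℕ; _≡ᵇ_)
open import Data.Fin using (Fin; _≟_)
open import Data.Bool using (Bool; true; false; _∧_; not)
open import Data.List using (List; []; _∷_; _++_; [_]; allFin)
open import Data.Bool.ListAction using (any)
open import Data.List.Relation.Unary.Unique.Propositional using (Unique)
open import Data.List.Relation.Unary.Linked using (Linked)
open import Data.Product using (Σ; ∃; _×_; _,_)
open import Relation.Nullary using (¬_)
open import Relation.Nullary.Decidable using (⌊_⌋)
open import Relation.Binary.PropositionalEquality using (_≡_)

record ColGraph : Set where
  field
    size       : ℕ
    adj        : Fin size → Fin size → Bool
    adj-sym    : ∀ x y → adj x y ≡ adj y x
    adj-irrefl : ∀ x → adj x x ≡ false
    col        : Fin size → ℕ

module _ (G : ColGraph) where
  open ColGraph G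

  Edge : Fin size → Fin size → Set
  Edge x y = adj x y ≡ true

  data Walk : Fin size → Fin size → Set where
    here : ∀ {x} → Walk x x
    step : ∀ {x y z} → Edge x y → Walk y z → Walk x z

  Connected : Set
  Connected = ∀ x y → Walk x y

  Cycle : Set
  Cycle = Σ (Fin size) λ x → Σ (Fin size) λ y → Σ (Fin size) λ z → Σ (List (Fin size)) λ rest →
            Unique (x ∷ y ∷ z ∷ rest) × Linked Edge (x ∷ y ∷ z ∷ rest ++ [ x ])

  Acyclic : Set
  Acyclic = ¬ Cycle

  IsTree : Set
  IsTree = Connected × Acyclic

  Colorful : Set
  Colorful = ∀ x y → col x ≡ col y → x ≡ y

  IsColorfulTree : Set
  IsColorfulTree = IsTree × Colorful

-- Intermediate graphs H are subgraphs of G described by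
-- their vertex set S : Fin n → Bool; the edge set of H is the set of edges of G
-- between vertices of S that survive the edge-deletion step.
module MCG (G T : ColGraph) where
  private
    module G = ColGraph G
    module T = ColGraph T
    n = G.size
    m = T.size

  -- vertex set after the first deletion step
  S₀ : Fin n → Bool
  S₀ v = any (λ w → G.col v ≡ᵇ T.col w) (allFin m)

  EdgeH : (Fin n → Bool) → Fin n → Fin n → Set
  EdgeH S v v' = S v ≡ true × S v' ≡ true × G.adj v v' ≡ true ×
                 Σ (Fin m) λ w → Σ (Fin m) λ w' →
                   T.adj w w' ≡ true × G.col v ≡ T.col w × G.col v' ≡ T.col w'

  -- the while-loop condition for v
  Violates : (Fin n → Bool) → Fin n → Set
  Violates S v = S v ≡ true × Σ (Fin m) λ w → Σ (Fin m) λ w' →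
                   G.col v ≡ T.col w × T.adj w w' ≡ true ×
                   ¬ (Σ (Fin n) λ v' → EdgeH S v v' × G.col v' ≡ T.col w')

  delete : (Fin n → Bool) → Fin n → Fin n → Bool
  delete S v x = S x ∧ not ⌊ x ≟ v ⌋

  -- Run S R : the while loop started at vertex set S may terminate with R
  -- (any choice of violating vertex at each step is allowed)
  data Run : (Fin n → Bool) → (Fin n → Bool) → Set where
    halt : ∀ {S} → (∀ v → ¬ Violates S v) → Run S S
    del  : ∀ {S R} v → Violates S v → Run (delete S v) R → Run S R

  IsOutput : (Fin n → Bool) → Set
  IsOutput R = Run S₀ R

  record ColIsoSubgraph (S : Fin n → Bool) : Set₁ where
    field
      V      : Fin n → Set
      E      : Fin n → Fin n → Set
      V⊆     : ∀ x → V x → S x ≡ true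
      E⊆     : ∀ x y → E x y → EdgeH S x y
      E-ends : ∀ x y → E x y → V x × V y
      φ      : Fin m → Fin n
      φ-inj  : ∀ w w' → φ w ≡ φ w' → w ≡ w'
      φ-into : ∀ w → V (φ w)
      φ-onto : ∀ x → V x → ∃ λ w → φ w ≡ x
      φ-col  : ∀ w → G.col (φ w) ≡ T.col w
      φ-edge : ∀ w w' → T.adj w w' ≡ true → E (φ w) (φ w')
      φ-edge⁻ : ∀ w w' → E (φ w) (φ w') → T.adj w w' ≡ true

-- Since mcg halts only when no vertex violates the loop condition, every vertex v of H
-- with c(v) = c(w) has, for each neighbour w' of w in T, a neighbour in H of color c(w').
-- Starting from φ(w) = x, φ(w') = y for an edge ww' of T with the colors of xy, grow a
-- color-preserving map φ from T into H one tree edge at a time, always along an edge uu'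
-- leaving the (connected) set of vertices already mapped.  Because T is a tree, u is the
-- only neighbour of u' among them, so adjacency to φ(u) is all that is required of φ(u').
-- Colorfulness of T makes the completed φ injective, and its image is the subgraph sought.
module Submission where

open import Defs
open import Data.Bool using (Bool; true)
import Data.Bool as Bool
open import Data.Fin using (Fin)
open import Data.Fin.Properties using (all?; any?; ¬∀⟶∃¬)
open import Data.Fin.Subset using (Subset; _∈_; _∉_; _⊆_; _⊂_; _⊃_; _∪_; ⁅_⁆; ⊤)
open import Data.Fin.Subset.Properties using (_∈?_; ∈⊤; x∈⁅x⁆; x∈⁅y⁆⇒x≡y; x∈p∪q⁺; x∈p∪q⁻; q⊆p∪q)
open import Data.Fin.Subset.Induction using (Acc; acc; ⊃-wellFounded)
open import Data.List using (List; []; _∷_; _++_; [_])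
open import Data.List.Relation.Unary.All using (All; []; _∷_)
import Data.List.Relation.Unary.All as All
open import Data.List.Relation.Unary.All.Properties using (++⁺)
open import Data.List.Relation.Unary.AllPairs using ([]; _∷_)
open import Data.List.Relation.Unary.Unique.Propositional using (Unique)
open import Data.List.Relation.Unary.Linked using (Linked; [-]; _∷_)
import Data.Nat as ℕ
open import Data.Product using (Σ; ∃; ∃₂; _×_; _,_; proj₁; proj₂)
open import Data.Sum using (_⊎_; inj₁; inj₂)
open import Data.Vec.Functional using (updateAt)
open import Data.Vec.Functional.Properties using (updateAt-updates; updateAt-minimal)
open import Function using (const)
open import Relation.Nullary using (¬_; yes; no; contradiction)
open import Relation.Nullary.Decidable using (decidable-stable; _×-dec_)
open import Relation.Binary.PropositionalEquality
  using (_≡_; _≢_; refl; sym; trans; cong; subst; subst₂; ≢-sym)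

module _ {n : ℕ.ℕ} {L : Subset n} {u : Fin n} where

  ∈-insert⁻ : ∀ {a} → a ∈ ⁅ u ⁆ ∪ L → a ≡ u ⊎ a ∈ L
  ∈-insert⁻ a∈ with x∈p∪q⁻ ⁅ u ⁆ L a∈
  ... | inj₁ a∈u = inj₁ (x∈⁅y⁆⇒x≡y u a∈u)
  ... | inj₂ a∈L = inj₂ a∈L

  ∈-insert-new : u ∈ ⁅ u ⁆ ∪ L
  ∈-insert-new = x∈p∪q⁺ (inj₁ (x∈⁅x⁆ u))

  ∈-insert-old : L ⊆ ⁅ u ⁆ ∪ L
  ∈-insert-old = q⊆p∪q ⁅ u ⁆ L

  ⊂-insert : u ∉ L → L ⊂ ⁅ u ⁆ ∪ L
  ⊂-insert u∉L = ∈-insert-old , u , ∈-insert-new , u∉L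

  ∈∧∉⇒≢ : ∀ {a} → a ∈ L → u ∉ L → a ≢ u
  ∈∧∉⇒≢ a∈L u∉L a≡u = u∉L (subst (_∈ L) a≡u a∈L)

  ∉⇒All≢ : ∀ {xs} → u ∉ L → All (_∈ L) xs → All (_≢ u) xs
  ∉⇒All≢ u∉L = All.map λ x∈L → ∈∧∉⇒≢ x∈L u∉L

module _ (G : ColGraph) where
  open ColGraph G

  Edge-sym : ∀ {x y} → Edge G x y → Edge G y x
  Edge-sym {x} {y} e = trans (adj-sym y x) e

  Edge-irrefl : ∀ {x} → ¬ Edge G x x
  Edge-irrefl {x} e = contradiction (trans (sym e) (adj-irrefl x)) λ ()

  data SimplePath : Fin size → Fin size → List (Fin size) → Set where
    []   : ∀ {a} → SimplePath a a []
    cons : ∀ {a b c l} → Edge G a c → All (a ≢_) (c ∷ l) → SimplePath c b l →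
           SimplePath a b (c ∷ l)

  SimplePath⇒Unique : ∀ {a b l} → SimplePath a b l → Unique (a ∷ l)
  SimplePath⇒Unique []             = [] ∷ []
  SimplePath⇒Unique (cons _ a∉ p) = a∉ ∷ SimplePath⇒Unique p

  SimplePath-∷ʳ-Linked : ∀ {a b c l} → SimplePath a b l → Edge G b c →
                         Linked (Edge G) (a ∷ l ++ [ c ])
  SimplePath-∷ʳ-Linked []             bc = bc ∷ [-]
  SimplePath-∷ʳ-Linked (cons ac _ p) bc = ac ∷ SimplePath-∷ʳ-Linked p bc

  SimplePath-∷ʳ : ∀ {a b c l} → SimplePath a b l → Edge G b c → All (_≢ c) (a ∷ l) →
                  SimplePath a c (l ++ [ c ])
  SimplePath-∷ʳ []             bc (a≢c ∷ []) = cons bc (a≢c ∷ []) []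
  SimplePath-∷ʳ (cons ad a∉ p) bc (a≢c ∷ c∉) = cons ad (++⁺ a∉ (a≢c ∷ [])) (SimplePath-∷ʳ p bc c∉)

  -- A nontrivial path a ⋯ b, closed up through a vertex c off it, is a cycle.
  Acyclic⇒path-ends-≡ : Acyclic G → ∀ {a b c l} → SimplePath a b l → All (_≢ c) (a ∷ l) →
                        Edge G a c → Edge G b c → b ≡ a
  Acyclic⇒path-ends-≡ acyclic []                  _  _  _  = refl
  Acyclic⇒path-ends-≡ acyclic {c = c} p@(cons {c = d} {l = l} _ _ _) c∉ ac bc =
    contradiction (c , _ , d , l , All.map ≢-sym c∉ ∷ SimplePath⇒Unique p ,
                   Edge-sym ac ∷ SimplePath-∷ʳ-Linked p bc)
                  acyclic

  ConnectedIn : Subset size → Set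
  ConnectedIn L = ∀ {a b} → a ∈ L → b ∈ L → ∃ λ l → SimplePath a b l × All (_∈ L) (a ∷ l)

  ConnectedIn-⁅⁆ : ∀ a → ConnectedIn ⁅ a ⁆
  ConnectedIn-⁅⁆ a a∈ b∈ with x∈⁅y⁆⇒x≡y a a∈ | x∈⁅y⁆⇒x≡y a b∈
  ... | refl | refl = [] , [] , x∈⁅x⁆ a ∷ []

  ConnectedIn-insert : ∀ {L u u'} → ConnectedIn L → u ∈ L → u' ∉ L → Edge G u u' →
                       ConnectedIn (⁅ u' ⁆ ∪ L)
  ConnectedIn-insert {u = u} {u'} conn u∈L u'∉L uu' a∈ b∈
    with ∈-insert⁻ a∈ | ∈-insert⁻ b∈
  ... | inj₁ refl | inj₁ refl = [] , [] , ∈-insert-new ∷ []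
  ... | inj₁ refl | inj₂ b∈L =
    let l , p , l⊆L = conn u∈L b∈L in
    u ∷ l , cons (Edge-sym uu') (All.map ≢-sym (∉⇒All≢ u'∉L l⊆L)) p ,
    ∈-insert-new ∷ All.map ∈-insert-old l⊆L
  ... | inj₂ a∈L | inj₁ refl =
    let l , p , l⊆L = conn a∈L u∈L in
    l ++ [ u' ] , SimplePath-∷ʳ p uu' (∉⇒All≢ u'∉L l⊆L) ,
    ++⁺ (All.map ∈-insert-old l⊆L) (∈-insert-new ∷ [])
  ... | inj₂ a∈L | inj₂ b∈L =
    let l , p , l⊆L = conn a∈L b∈L in
    l , p , All.map ∈-insert-old l⊆L

  ConnectedIn⇒unique-neighbour : Acyclic G → ∀ {L u b c} → ConnectedIn L → u ∈ L → b ∈ L →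
                                 c ∉ L → Edge G u c → Edge G b c → b ≡ u
  ConnectedIn⇒unique-neighbour acyclic conn u∈L b∈L c∉L uc bc =
    let _ , p , l⊆L = conn u∈L b∈L in
    Acyclic⇒path-ends-≡ acyclic p (∉⇒All≢ c∉L l⊆L) uc bc

  Walk⇒boundary-edge : ∀ {L a b} → Walk G a b → a ∈ L → b ∉ L →
                       ∃₂ λ u u' → u ∈ L × u' ∉ L × Edge G u u'
  Walk⇒boundary-edge here a∈L b∉L = contradiction a∈L b∉L
  Walk⇒boundary-edge {L} {a} (step {y = c} ac p) a∈L b∉L with c ∈? L
  ... | yes c∈L = Walk⇒boundary-edge p c∈L b∉L
  ... | no  c∉L = a , c , a∈L , c∉L , ac

Run⇒stable : ∀ G T {S R} → MCG.Run G T S R → ∀ v → ¬ MCG.Violates G T R v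
Run⇒stable G T (MCG.halt stable) = stable
Run⇒stable G T (MCG.del _ _ run) = Run⇒stable G T run

module Embedding (G T : ColGraph) (T-tree : IsColorfulTree T) (R : Fin (ColGraph.size G) → Bool)
                 (R-stable : ∀ v → ¬ MCG.Violates G T R v) where
  private
    module G = ColGraph G
    module T = ColGraph T
  open MCG G T

  stable⇒neighbour : ∀ {v a a'} → R v ≡ true → G.col v ≡ T.col a → Edge T a a' →
                     ∃ λ v' → R v' ≡ true × Edge G v v' × G.col v' ≡ T.col a'
  stable⇒neighbour {v} {a} {a'} Rv va aa' =
    decidable-stable (any? λ v' → (R v' Bool.≟ true) ×-dec (G.adj v v' Bool.≟ true)
                                  ×-dec (G.col v' ℕ.≟ T.col a'))
      λ none → R-stable v (Rv , a , a' , va , aa' ,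
                           λ (v' , (_ , Rv' , vv' , _) , v'a') → none (v' , Rv' , vv' , v'a'))

  record ColHomOn (L : Subset T.size) (φ : Fin T.size → Fin G.size) : Set where
    field
      φ-∈R   : ∀ {a} → a ∈ L → R (φ a) ≡ true
      φ-col  : ∀ {a} → a ∈ L → G.col (φ a) ≡ T.col a
      φ-edge : ∀ {a b} → a ∈ L → b ∈ L → Edge T a b → Edge G (φ a) (φ b)
  open ColHomOn

  ColHomOn-⊆ : ∀ {L L' φ} → L' ⊆ L → ColHomOn L φ → ColHomOn L' φ
  ColHomOn-⊆ L'⊆L hom = record
    { φ-∈R   = λ a∈ → φ-∈R hom (L'⊆L a∈)
    ; φ-col  = λ a∈ → φ-col hom (L'⊆L a∈)
    ; φ-edge = λ a∈ b∈ → φ-edge hom (L'⊆L a∈) (L'⊆L b∈)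
    }

  ColHomOn-insert : ∀ {L φ u u' v} → ConnectedIn T L → ColHomOn L φ →
                    u ∈ L → u' ∉ L → Edge T u u' →
                    R v ≡ true → Edge G (φ u) v → G.col v ≡ T.col u' →
                    ColHomOn (⁅ u' ⁆ ∪ L) (updateAt φ u' (const v))
  ColHomOn-insert {L} {φ} {u} {u'} {v} conn hom u∈L u'∉L uu' Rv φu-v vu' =
    record { φ-∈R = ψ-∈R ; φ-col = ψ-col ; φ-edge = ψ-edge }
    where
    ψ : Fin T.size → Fin G.size
    ψ = updateAt φ u' (const v)

    ψ-new : ψ u' ≡ v
    ψ-new = updateAt-updates u' φ

    ψ-old : ∀ {a} → a ∈ L → ψ a ≡ φ a
    ψ-old {a} a∈L = updateAt-minimal a u' φ (∈∧∉⇒≢ a∈L u'∉L)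

    ψ-∈R : ∀ {a} → a ∈ ⁅ u' ⁆ ∪ L → R (ψ a) ≡ true
    ψ-∈R a∈ with ∈-insert⁻ a∈
    ... | inj₁ refl = subst (λ x → R x ≡ true) (sym ψ-new) Rv
    ... | inj₂ a∈L  = subst (λ x → R x ≡ true) (sym (ψ-old a∈L)) (φ-∈R hom a∈L)

    ψ-col : ∀ {a} → a ∈ ⁅ u' ⁆ ∪ L → G.col (ψ a) ≡ T.col a
    ψ-col a∈ with ∈-insert⁻ a∈
    ... | inj₁ refl = trans (cong G.col ψ-new) vu'
    ... | inj₂ a∈L  = trans (cong G.col (ψ-old a∈L)) (φ-col hom a∈L)

    ψ-edge-new : ∀ {b} → b ∈ L → Edge T b u' → Edge G (ψ b) (ψ u')
    ψ-edge-new b∈L bu'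
      with ConnectedIn⇒unique-neighbour T (proj₂ (proj₁ T-tree)) conn u∈L b∈L u'∉L uu' bu'
    ... | refl = subst₂ (Edge G) (sym (ψ-old u∈L)) (sym ψ-new) φu-v

    ψ-edge : ∀ {a b} → a ∈ ⁅ u' ⁆ ∪ L → b ∈ ⁅ u' ⁆ ∪ L → Edge T a b → Edge G (ψ a) (ψ b)
    ψ-edge a∈ b∈ ab with ∈-insert⁻ a∈ | ∈-insert⁻ b∈
    ... | inj₁ refl | inj₁ refl = contradiction ab (Edge-irrefl T)
    ... | inj₁ refl | inj₂ b∈L  = Edge-sym G (ψ-edge-new b∈L (Edge-sym T ab))
    ... | inj₂ a∈L  | inj₁ refl = ψ-edge-new a∈L ab
    ... | inj₂ a∈L  | inj₂ b∈L  =
      subst₂ (Edge G) (sym (ψ-old a∈L)) (sym (ψ-old b∈L)) (φ-edge hom a∈L b∈L ab)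

  ColHomOn-extend : ∀ {L φ w} → Acc _⊃_ L → ConnectedIn T L → w ∈ L → ColHomOn L φ →
                    ∃ λ φ' → ColHomOn ⊤ φ' × (∀ {a} → a ∈ L → φ' a ≡ φ a)
  ColHomOn-extend {L} {φ} {w} (acc larger) conn w∈L hom with all? (_∈? L)
  ... | yes all∈L = φ , ColHomOn-⊆ (λ {a} _ → all∈L a) hom , λ _ → refl
  ... | no ¬all∈L =
    let z , z∉L              = ¬∀⟶∃¬ _ (_∈ L) (_∈? L) ¬all∈L
        u , u' , u∈L , u'∉L , uu' = Walk⇒boundary-edge T (proj₁ (proj₁ T-tree) w z) w∈L z∉L
        v , Rv , φu-v , vu'  = stable⇒neighbour (φ-∈R hom u∈L) (φ-col hom u∈L) uu'
        φ' , hom' , φ'-agrees =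
          ColHomOn-extend (larger (⊂-insert u'∉L)) (ConnectedIn-insert T conn u∈L u'∉L uu')
            (∈-insert-old w∈L) (ColHomOn-insert conn hom u∈L u'∉L uu' Rv φu-v vu')
    in φ' , hom' , λ a∈L →
         trans (φ'-agrees (∈-insert-old a∈L)) (updateAt-minimal _ u' φ (∈∧∉⇒≢ a∈L u'∉L))

  ColHomOn-⁅⁆ : ∀ {w x} → R x ≡ true → G.col x ≡ T.col w → ColHomOn ⁅ w ⁆ (const x)
  ColHomOn-⁅⁆ {w} Rx xw = record
    { φ-∈R   = λ _ → Rx
    ; φ-col  = λ a∈ → trans xw (cong T.col (sym (x∈⁅y⁆⇒x≡y w a∈)))
    ; φ-edge = λ a∈ b∈ ab →
        contradiction (subst₂ (Edge T) (x∈⁅y⁆⇒x≡y w a∈) (x∈⁅y⁆⇒x≡y w b∈) ab) (Edge-irrefl T)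
    }

  edge⇒ColHom : ∀ {x y w w'} → EdgeH R x y → Edge T w w' →
                G.col x ≡ T.col w → G.col y ≡ T.col w' →
                ∃ λ φ → ColHomOn ⊤ φ × φ w ≡ x × φ w' ≡ y
  edge⇒ColHom {x} {y} {w} {w'} (Rx , Ry , xy , _) ww' xw yw' =
    let w∈      = x∈⁅x⁆ w
        w'∉     = λ w'∈ → Edge-irrefl T (subst (Edge T w) (x∈⁅y⁆⇒x≡y w w'∈) ww')
        w≢w'    = λ w≡w' → w'∉ (subst (_∈ ⁅ w ⁆) w≡w' w∈)
        φ , hom , φ-agrees =
          ColHomOn-extend (⊃-wellFounded _) (ConnectedIn-insert T (ConnectedIn-⁅⁆ T w) w∈ w'∉ ww')
            (∈-insert-old w∈)
            (ColHomOn-insert (ConnectedIn-⁅⁆ T w) (ColHomOn-⁅⁆ Rx xw) w∈ w'∉ ww' Ry xy yw')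
    in φ , hom , trans (φ-agrees (∈-insert-old w∈)) (updateAt-minimal w w' _ w≢w') ,
                 trans (φ-agrees ∈-insert-new) (updateAt-updates w' _)

  ColHom⇒injective : ∀ {φ} → ColHomOn ⊤ φ → ∀ a b → φ a ≡ φ b → a ≡ b
  ColHom⇒injective hom a b φa≡φb =
    proj₂ T-tree a b (trans (sym (φ-col hom ∈⊤)) (trans (cong G.col φa≡φb) (φ-col hom ∈⊤)))

  ColHom⇒ColIsoSubgraph : ∀ {φ} → ColHomOn ⊤ φ → ColIsoSubgraph R
  ColHom⇒ColIsoSubgraph {φ} hom = record
    { V       = λ x → ∃ λ a → φ a ≡ x
    ; E       = λ x y → ∃₂ λ a b → φ a ≡ x × φ b ≡ y × Edge T a b
    ; V⊆      = λ { _ (a , refl) → φ-∈R hom ∈⊤ }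
    ; E⊆      = λ { _ _ (a , b , refl , refl , ab) →
                    φ-∈R hom ∈⊤ , φ-∈R hom ∈⊤ , φ-edge hom ∈⊤ ∈⊤ ab ,
                    a , b , ab , φ-col hom ∈⊤ , φ-col hom ∈⊤ }
    ; E-ends  = λ { _ _ (a , b , φa , φb , _) → (a , φa) , (b , φb) }
    ; φ       = φ
    ; φ-inj   = ColHom⇒injective hom
    ; φ-into  = λ a → a , refl
    ; φ-onto  = λ _ a↦x → a↦x
    ; φ-col   = λ _ → φ-col hom ∈⊤
    ; φ-edge  = λ a b ab → a , b , refl , refl , ab
    ; φ-edge⁻ = λ { a b (a' , b' , φa'≡φa , φb'≡φb , a'b') →
                    subst₂ (Edge T) (ColHom⇒injective hom a' a φa'≡φa)
                                    (ColHom⇒injective hom b' b φb'≡φb) a'b' }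
    }

lemma3 : (G T : ColGraph) → IsColorfulTree T → (R : Fin (ColGraph.size G) → Bool) →
           MCG.IsOutput G T R → ∀ x y → MCG.EdgeH G T R x y →
           Σ (MCG.ColIsoSubgraph G T R) (λ H̃ → MCG.ColIsoSubgraph.E H̃ x y)
lemma3 G T T-tree R run x y xy@(_ , _ , _ , w , w' , ww' , xw , yw') =
  let φ , hom , φw≡x , φw'≡y = edge⇒ColHom xy ww' xw yw'
  in ColHom⇒ColIsoSubgraph hom , w , w' , φw≡x , φw'≡y , ww'
  where open Embedding G T T-tree R (Run⇒stable G T run)
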